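{- Let $p$ be an odd prime and $v$ an $m$-dimensional integral vector each of whose entries is nonzero modulo $p$. For each $k\in\{1,2,\ldots,p-1\}$, let $\mathcal{R}_k$ be the set of all perfect $p$-representatives of $kv$. Then $v$ can generate a primitive matrix if and only if $\sum_{k=1}^{p-1}|\mathcal{R}_k|=m$.
   Context: $e$ is the all-one vector. For integral vectors $v,w$, $w$ is a perfect $p$-representative of $v$ if $w\equiv v\pmod p$, $w^{\mathrm T}e=p$ and $w^{\mathrm T}w=p^2$. An orthogonal matrix $Q$ is regular if $Qe=e$; the level of a rational matrix $Q$ is the least positive integer $k$ with $kQ$ integral. A primitive matrix is a regular rational orthogonal matrix $Q$ of level $p$ such that $pQ$ has rank $1$ over $\mathbb{F}_p=\mathbb{Z}/p\mathbb{Z}$. An integral $m$-dimensional vector $v$ generates an $m\times m$ primitive matrix $Q$ if each column of $pQ$ is a multiple of $v$ over $\mathbb{F}_p$. -}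

module Defs where

open import Data.Nat as ℕ using (ℕ; zero; suc; _<_; _≤_)
open import Data.Integer as ℤ using (ℤ; +_) renaming (_*_ to _*ℤ_; _-_ to _-ℤ_; _+_ to _+ℤ_)
open import Data.Integer.Divisibility using () renaming (_∣_ to _∣ℤ_)
open import Data.Rational as ℚ using (ℚ; 0ℚ; 1ℚ; ↥_) renaming (_*_ to _*ℚ_; _+_ to _+ℚ_)
open import Data.Fin using (Fin; zero; suc)
open import Data.Vec using (Vec; lookup; map)
open import Data.List using (List; length)
open import Data.List.Relation.Unary.Unique.Propositional using (Unique)
open import Data.List.Membership.Propositional using (_∈_)
open import Data.Product using (Σ; ∃; ∃₂; _×_)
open import Function.Bundles using (_⇔_)
open import Relation.Nullary using (¬_)
open import Relation.Binary.PropositionalEquality using (_≡_; _≢_)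

Matrix : ℕ → Set
Matrix m = Fin m → Fin m → ℚ

sumℚ : ∀ {m} → (Fin m → ℚ) → ℚ
sumℚ {zero} f = 0ℚ
sumℚ {suc m} f = f zero +ℚ sumℚ (λ i → f (suc i))

sumℤ : ∀ {m} → (Fin m → ℤ) → ℤ
sumℤ {zero} f = + 0
sumℤ {suc m} f = f zero +ℤ sumℤ (λ i → f (suc i))

sumTo : ℕ → (ℕ → ℕ) → ℕ
sumTo zero f = 0
sumTo (suc n) f = sumTo n f ℕ.+ f (suc n)

δ : ∀ {m} → Fin m → Fin m → ℚ
δ zero zero = 1ℚ
δ zero (suc j) = 0ℚ
δ (suc i) zero = 0ℚ
δ (suc i) (suc j) = δ i j

Orthogonal : ∀ {m} → Matrix m → Set
Orthogonal {m} Q = ∀ i j → sumℚ (λ k → Q k i *ℚ Q k j) ≡ δ i j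

Regular : ∀ {m} → Matrix m → Set
Regular {m} Q = ∀ i → sumℚ (λ j → Q i j) ≡ 1ℚ

IsIntegral : ℚ → Set
IsIntegral q = ∃ λ (z : ℤ) → q ≡ z ℚ./ 1

scale : ∀ {m} → ℕ → Matrix m → Matrix m
scale k Q i j = (+ k ℚ./ 1) *ℚ Q i j

IntegralMatrix : ∀ {m} → Matrix m → Set
IntegralMatrix Q = ∀ i j → IsIntegral (Q i j)

HasLevel : ∀ {m} → Matrix m → ℕ → Set
HasLevel Q ℓ = 1 ≤ ℓ × IntegralMatrix (scale ℓ Q)
             × (∀ k → 1 ≤ k → k < ℓ → ¬ IntegralMatrix (scale k Q))

_≡_[mod_] : ℤ → ℤ → ℕ → Set
a ≡ b [mod p ] = (+ p) ∣ℤ (a -ℤ b)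

-- integer entries of pQ (meaningful when pQ is integral)
pQℤ : ∀ {m} → ℕ → Matrix m → Fin m → Fin m → ℤ
pQℤ p Q i j = ↥ (scale p Q i j)

Rank1Mod : ∀ {m} → ℕ → (Fin m → Fin m → ℤ) → Set
Rank1Mod {m} p M =
  (∃₂ λ i j → ¬ (M i j ≡ + 0 [mod p ]))
  × (∃ λ (u : Fin m → ℤ) → (∃ λ i → ¬ (u i ≡ + 0 [mod p ]))
       × (∀ j → ∃ λ (c : ℤ) → ∀ i → M i j ≡ c *ℤ u i [mod p ]))

Primitive : ∀ {m} → ℕ → Matrix m → Set
Primitive p Q = Regular Q × Orthogonal Q × HasLevel Q p × Rank1Mod p (pQℤ p Q)

Generates : ∀ {m} → ℕ → Vec ℤ m → Matrix m → Set
Generates {m} p v Q =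
  Primitive p Q × (∀ j → ∃ λ (c : ℤ) → ∀ i → pQℤ p Q i j ≡ c *ℤ lookup v i [mod p ])

CanGenerate : ∀ {m} → ℕ → Vec ℤ m → Set
CanGenerate {m} p v = ∃ λ (Q : Matrix m) → Generates p v Q

PerfectRep : ∀ {m} → ℕ → Vec ℤ m → Vec ℤ m → Set
PerfectRep {m} p v w =
  (∀ i → lookup w i ≡ lookup v i [mod p ])
  × sumℤ (λ i → lookup w i) ≡ + p
  × sumℤ (λ i → lookup w i *ℤ lookup w i) ≡ + (p ℕ.* p)

HasCard : ∀ {m} → (Vec ℤ m → Set) → ℕ → Set
HasCard {m} P n = Σ (List (Vec ℤ m)) λ L →
  Unique L × (∀ w → (w ∈ L) ⇔ P w) × length L ≡ n

_·_ : ∀ {m} → ℕ → Vec ℤ m → Vec ℤ m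
k · v = map (λ x → + k *ℤ x) v

-- For a primitive Q generated by v, the integer matrix pQ has row sums p (Q e = e) and mutually
-- orthogonal columns of norm p² (QᵀQ = I); orthogonality turns the row sums into column sums p, and
-- every column is congruent to c v mod p with p ∤ c, so the columns are m distinct perfect
-- p-representatives of multiples of v. Conversely, m pairwise orthogonal such representatives are the
-- columns of pQ for a primitive Q. The key fact is that perfect representatives w, x of k v and k′ v
-- are orthogonal or equal: k′w − kx ≡ 0 (mod p) makes ‖k′w − kx‖² = (k′² + k²)p² − 2kk′ w·x divisible
-- by p², hence p² ∣ w·x as p is odd; writing w·x = t p², ‖w ∓ x‖² = 2(1 ∓ t)p² ≥ 0 leaves
-- t ∈ {−1, 0, 1}, and t = −1 would mean w = −x although Σw = Σx = p. So the sets R_k are disjoint,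
-- and every representative w is a column, since its inner products with the columns add up to
-- w·(row sums) = pΣw = p² ≠ 0. Counting R_1 ∪ … ∪ R_(p−1) in both ways gives Σ|R_k| = m.

module Submission where

open import Defs
open import Data.Empty using (⊥; ⊥-elim)
open import Data.Fin using (Fin; zero; suc; _≟_)
import Data.Fin as Fin
import Data.Fin.Properties as Fin
open import Data.Integer as ℤ
  using (ℤ; +_; -[1+_]; +0; +[1+_]; +≤+; 0ℤ; 1ℤ; -1ℤ; _+_; _-_; _*_; -_)
open import Data.Integer.DivMod using (a≡a%ℕn+[a/ℕn]*n; n%ℕd<d)
open import Data.Integer.Divisibility using () renaming (_∣_ to _∣ℤ_)
open import Data.Integer.Divisibility.Signed
  using (_∣_; divides; ∣⇒∣ᵤ; ∣ᵤ⇒∣; ∣-refl; ∣-reflexive; ∣-trans; ∣m∣n⇒∣m+n; ∣m∣n⇒∣m-n; ∣m⇒∣m*n; ∣n⇒∣m*n; *-cancelʳ-∣)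
import Data.Integer.Properties as ℤ
open import Data.Integer.Tactic.RingSolver using (solve-∀)
open import Data.List as List using (List; []; _++_)
open import Data.List.Properties using (length-++; length-tabulate)
open import Data.List.Membership.Propositional using (_∈_)
open import Data.List.Membership.Propositional.Properties
  using (∈-++⁺ˡ; ∈-++⁺ʳ; ∈-++⁻; ∈-tabulate⁺; ∈-tabulate⁻; ∈-lookup)
open import Data.List.Membership.Propositional.Properties.WithK using (unique∧set⇒bag)
open import Data.List.Relation.Binary.BagAndSetEquality using (∼bag⇒↭)
open import Data.List.Relation.Binary.Permutation.Propositional.Properties using (↭-length)
import Data.List.Relation.Unary.All as All
open import Data.List.Relation.Unary.Unique.Propositional using (Unique; []; _∷_)
open import Data.List.Relation.Unary.Unique.Propositional.Properties using (++⁺; tabulate⁺)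
open import Data.Nat as ℕ using (ℕ; zero; suc; _≤_; _<_; _∸_; _⊔_; NonZero)
import Data.Nat.Coprimality as Coprime
import Data.Nat.Divisibility as ℕ
open import Data.Nat.Primality using (Prime; euclidsLemma; prime⇒nonZero; prime⇒nonTrivial)
import Data.Nat.Properties as ℕ
open import Data.Product using (∃; ∃₂; _×_; _,_; proj₁; proj₂)
open import Data.Rational as ℚ using (ℚ; 0ℚ; 1ℚ; 1/_; toℚᵘ)
import Data.Rational.Properties as ℚ
open import Data.Rational.Unnormalised as ℚᵘ using (mkℚᵘ; *≡*) renaming (_≃_ to _≃ᵘ_)
import Data.Rational.Unnormalised.Properties as ℚᵘ
open import Data.Sum using (_⊎_; inj₁; inj₂; [_,_]′)
open import Data.Vec using (Vec; lookup; tabulate)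
import Data.Vec.Properties as Vec
open import Data.Vec.Relation.Binary.Pointwise.Extensional using (ext; Pointwise-≡⇒≡)
open import Function using (_∘_; id)
open import Function.Bundles using (_⇔_; mk⇔; Equivalence)
import Function.Properties.Equivalence as ⇔
open import Relation.Nullary using (¬_; yes; no; contradiction)
open import Relation.Nullary.Decidable using (decidable-stable)
open import Relation.Binary.PropositionalEquality
open import Algebra.Bundles using (CommutativeMonoid)
open import Algebra.Properties.CommutativeSemigroup
  (CommutativeMonoid.commutativeSemigroup ℚ.*-1-commutativeMonoid) using (interchange)
open import Algebra.Properties.Semiring.Sum ℤ.+-*-semiring as Σ using (sum)

-- Finite sums and dot products

sumℤ≡sum : ∀ {m} (f : Fin m → ℤ) → sumℤ f ≡ sum f
sumℤ≡sum {zero}  f = refl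
sumℤ≡sum {suc m} f = cong (λ s → f zero + s) (sumℤ≡sum (f ∘ suc))

module _ {m : ℕ} where
  open ≡-Reasoning

  sum-cong : {f g : Fin m → ℤ} → (∀ i → f i ≡ g i) → sumℤ f ≡ sumℤ g
  sum-cong {f} {g} f≗g = begin
    sumℤ f  ≡⟨ sumℤ≡sum f ⟩
    sum f   ≡⟨ Σ.sum-cong-≗ f≗g ⟩
    sum g   ≡⟨ sumℤ≡sum g ⟨
    sumℤ g  ∎

  sum-+ : (f g : Fin m → ℤ) → sumℤ (λ i → f i + g i) ≡ sumℤ f + sumℤ g
  sum-+ f g = begin
    sumℤ (λ i → f i + g i)  ≡⟨ sumℤ≡sum (λ i → f i + g i) ⟩
    sum (λ i → f i + g i)   ≡⟨ Σ.∑-distrib-+ f g ⟩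
    sum f + sum g           ≡⟨ cong₂ _+_ (sumℤ≡sum f) (sumℤ≡sum g) ⟨
    sumℤ f + sumℤ g         ∎

  sum-*ˡ : (c : ℤ) (f : Fin m → ℤ) → sumℤ (λ i → c * f i) ≡ c * sumℤ f
  sum-*ˡ c f = begin
    sumℤ (λ i → c * f i)  ≡⟨ sumℤ≡sum (λ i → c * f i) ⟩
    sum (λ i → c * f i)   ≡⟨ Σ.*-distribˡ-sum c f ⟨
    c * sum f             ≡⟨ cong (c *_) (sumℤ≡sum f) ⟨
    c * sumℤ f            ∎

  sum-*ʳ : (c : ℤ) (f : Fin m → ℤ) → sumℤ (λ i → f i * c) ≡ sumℤ f * c
  sum-*ʳ c f = begin
    sumℤ (λ i → f i * c)  ≡⟨ sum-cong (λ i → ℤ.*-comm (f i) c) ⟩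
    sumℤ (λ i → c * f i)  ≡⟨ sum-*ˡ c f ⟩
    c * sumℤ f            ≡⟨ ℤ.*-comm c _ ⟩
    sumℤ f * c            ∎

sum-swap : ∀ {m n} (f : Fin m → Fin n → ℤ) →
           sumℤ (λ i → sumℤ (f i)) ≡ sumℤ (λ j → sumℤ (λ i → f i j))
sum-swap f = begin
  sumℤ (λ i → sumℤ (f i))               ≡⟨ sum-cong (λ i → sumℤ≡sum (f i)) ⟩
  sumℤ (λ i → sum (f i))                ≡⟨ sumℤ≡sum (λ i → sum (f i)) ⟩
  sum (λ i → sum (f i))                 ≡⟨ Σ.∑-comm f ⟩
  sum (λ j → sum (λ i → f i j))         ≡⟨ sumℤ≡sum (λ j → sum (λ i → f i j)) ⟨
  sumℤ (λ j → sum (λ i → f i j))        ≡⟨ sum-cong (λ j → sumℤ≡sum (λ i → f i j)) ⟨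
  sumℤ (λ j → sumℤ (λ i → f i j))       ∎
  where open ≡-Reasoning

sum-const : ∀ m (c : ℤ) → sumℤ {m} (λ _ → c) ≡ + m * c
sum-const zero    c = refl
sum-const (suc m) c = trans (cong (λ s → c + s) (sum-const m c)) (lemma c (+ m))
  where
  lemma : ∀ c x → c + x * c ≡ (1ℤ + x) * c
  lemma = solve-∀

sum-≡0 : ∀ {m} {f : Fin m → ℤ} → (∀ i → f i ≡ 0ℤ) → sumℤ f ≡ 0ℤ
sum-≡0 {m} f≡0 = trans (sum-cong f≡0) (trans (sum-const m 0ℤ) (ℤ.*-zeroʳ (+ m)))

sum-single : ∀ {m} (f : Fin m → ℤ) j → (∀ l → l ≢ j → f l ≡ 0ℤ) → sumℤ f ≡ f j
sum-single {suc m} f zero    f≡0 =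
  trans (cong (λ s → f zero + s) (sum-≡0 (λ l → f≡0 (suc l) λ ()))) (ℤ.+-identityʳ (f zero))
sum-single {suc m} f (suc j) f≡0 =
  trans (cong₂ _+_ (f≡0 zero λ ()) (sum-single (f ∘ suc) j (λ l l≢j → f≡0 (suc l) (l≢j ∘ Fin.suc-injective))))
        (ℤ.+-identityˡ (f (suc j)))

sum-nonneg : ∀ {m} {f : Fin m → ℤ} → (∀ i → 0ℤ ℤ.≤ f i) → 0ℤ ℤ.≤ sumℤ f
sum-nonneg {zero}  f≥0 = ℤ.≤-refl
sum-nonneg {suc m} f≥0 = ℤ.+-mono-≤ (f≥0 zero) (sum-nonneg (f≥0 ∘ suc))

sum-nonneg-≡0 : ∀ {m} {f : Fin m → ℤ} → (∀ i → 0ℤ ℤ.≤ f i) → sumℤ f ≡ 0ℤ → ∀ i → f i ≡ 0ℤ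
sum-nonneg-≡0 {suc m} {f} f≥0 Σ≡0 = λ where
    zero    → f₀≡0
    (suc i) → sum-nonneg-≡0 (f≥0 ∘ suc) rest≡0 i
  where
  rest≥0 : 0ℤ ℤ.≤ sumℤ (f ∘ suc)
  rest≥0 = sum-nonneg (f≥0 ∘ suc)
  f₀≡0 : f zero ≡ 0ℤ
  f₀≡0 = ℤ.≤-antisym
    (subst (λ x → x ℤ.≤ 0ℤ) (ℤ.+-identityʳ (f zero))
      (subst (λ x → f zero + 0ℤ ℤ.≤ x) Σ≡0 (ℤ.+-monoʳ-≤ (f zero) rest≥0)))
    (f≥0 zero)
  rest≡0 : sumℤ (f ∘ suc) ≡ 0ℤ
  rest≡0 = trans (sym (ℤ.+-identityˡ _)) (trans (cong (_+ sumℤ (f ∘ suc)) (sym f₀≡0)) Σ≡0)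

sum≢0⇒∃ : ∀ {m} {P : Fin m → Set} (f : Fin m → ℤ) →
          (∀ i → f i ≡ 0ℤ ⊎ P i) → sumℤ f ≢ 0ℤ → ∃ P
sum≢0⇒∃ {zero}  f alt Σ≢0 = ⊥-elim (Σ≢0 refl)
sum≢0⇒∃ {suc m} f alt Σ≢0 with alt zero
... | inj₂ P₀ = zero , P₀
... | inj₁ f₀≡0 with sum≢0⇒∃ (f ∘ suc) (alt ∘ suc) (λ rest≡0 → Σ≢0 (cong₂ _+_ f₀≡0 rest≡0))
...   | i , Pᵢ = suc i , Pᵢ

i*i≥0 : ∀ i → 0ℤ ℤ.≤ i * i
i*i≥0 +0        = +≤+ ℕ.z≤n
i*i≥0 +[1+ n ]  = +≤+ ℕ.z≤n
i*i≥0 -[1+ n ]  = +≤+ ℕ.z≤n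

i≢0⇒i*i≥1 : ∀ i → i ≢ 0ℤ → 1ℤ ℤ.≤ i * i
i≢0⇒i*i≥1 +0       i≢0 = ⊥-elim (i≢0 refl)
i≢0⇒i*i≥1 +[1+ n ] _   = +≤+ (ℕ.s≤s ℕ.z≤n)
i≢0⇒i*i≥1 -[1+ n ] _   = +≤+ (ℕ.s≤s ℕ.z≤n)

dot : ∀ {m} → (Fin m → ℤ) → (Fin m → ℤ) → ℤ
dot u w = sumℤ (λ i → u i * w i)

dot-self-nonneg : ∀ {m} (w : Fin m → ℤ) → 0ℤ ℤ.≤ dot w w
dot-self-nonneg w = sum-nonneg (λ i → i*i≥0 (w i))

dot-self≡0 : ∀ {m} (w : Fin m → ℤ) → dot w w ≡ 0ℤ → ∀ i → w i ≡ 0ℤ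
dot-self≡0 w ‖w‖²≡0 i with ℤ.i*j≡0⇒i≡0∨j≡0 (w i) (sum-nonneg-≡0 (λ i → i*i≥0 (w i)) ‖w‖²≡0 i)
... | inj₁ wᵢ≡0 = wᵢ≡0
... | inj₂ wᵢ≡0 = wᵢ≡0

dot-expand : ∀ {m} (a b : ℤ) (u w y : Fin m → ℤ) → (∀ i → y i ≡ a * u i + b * w i) →
             dot y y ≡ a * a * dot u u + + 2 * a * b * dot u w + b * b * dot w w
dot-expand {m} a b u w y y≡ = begin
  sumℤ (λ i → y i * y i)
    ≡⟨ sum-cong (λ i → trans (cong (λ z → z * z) (y≡ i)) (square a b (u i) (w i))) ⟩
  sumℤ (λ i → a * a * uu i + + 2 * a * b * uw i + b * b * ww i)
    ≡⟨ trans (sum-+ (λ i → a * a * uu i + + 2 * a * b * uw i) (λ i → b * b * ww i))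
             (cong (_+ sumℤ (λ i → b * b * ww i)) (sum-+ (λ i → a * a * uu i) (λ i → + 2 * a * b * uw i))) ⟩
  sumℤ (λ i → a * a * uu i) + sumℤ (λ i → + 2 * a * b * uw i) + sumℤ (λ i → b * b * ww i)
    ≡⟨ cong₂ _+_ (cong₂ _+_ (sum-*ˡ (a * a) uu) (sum-*ˡ (+ 2 * a * b) uw)) (sum-*ˡ (b * b) ww) ⟩
  a * a * dot u u + + 2 * a * b * dot u w + b * b * dot w w ∎
  where
  open ≡-Reasoning
  uu uw ww : Fin m → ℤ
  uu i = u i * u i
  uw i = u i * w i
  ww i = w i * w i
  square : ∀ a b x z → (a * x + b * z) * (a * x + b * z)
                     ≡ a * a * (x * x) + + 2 * a * b * (x * z) + b * b * (z * z)
  square = solve-∀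

norm≡1⇒unit : ∀ {m} (u : Fin m → ℤ) → dot u u ≡ 1ℤ →
              ∃ λ i → u i ≢ 0ℤ × (∀ l → l ≢ i → u l ≡ 0ℤ)
norm≡1⇒unit {suc m} u ‖u‖²≡1 with u zero ℤ.≟ 0ℤ
... | yes u₀≡0 =
  let i , uᵢ≢0 , others = norm≡1⇒unit (u ∘ suc) ‖rest‖²≡1 in
  suc i , uᵢ≢0 , λ where
    zero    _   → u₀≡0
    (suc l) l≢i → others l (l≢i ∘ cong suc)
  where
  ‖rest‖²≡1 : dot (u ∘ suc) (u ∘ suc) ≡ 1ℤ
  ‖rest‖²≡1 = trans (sym (ℤ.+-identityˡ _))
    (trans (cong (λ x → x * x + dot (u ∘ suc) (u ∘ suc)) (sym u₀≡0)) ‖u‖²≡1)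
... | no u₀≢0 = zero , u₀≢0 , λ where
    zero    0≢0 → ⊥-elim (0≢0 refl)
    (suc l) _   → dot-self≡0 (u ∘ suc) ‖rest‖²≡0 l
  where
  ‖rest‖² : ℤ
  ‖rest‖² = dot (u ∘ suc) (u ∘ suc)
  ‖rest‖²≤0 : ‖rest‖² ℤ.≤ 0ℤ
  ‖rest‖²≤0 = subst (λ x → x ℤ.≤ 0ℤ)
    (trans (cong (_- u zero * u zero) (sym ‖u‖²≡1)) (cancel (u zero * u zero) ‖rest‖²))
    (ℤ.i≤j⇒i-j≤0 (i≢0⇒i*i≥1 (u zero) u₀≢0))
    where
    cancel : ∀ a r → a + r - a ≡ r
    cancel = solve-∀
  ‖rest‖²≡0 : ‖rest‖² ≡ 0ℤ
  ‖rest‖²≡0 = ℤ.≤-antisym ‖rest‖²≤0 (dot-self-nonneg (u ∘ suc))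

dot-comm : ∀ {m} (u w : Fin m → ℤ) → dot u w ≡ dot w u
dot-comm u w = sum-cong (λ i → ℤ.*-comm (u i) (w i))

orthogonal-to-unit : ∀ {m} (x u : Fin m → ℤ) → dot u u ≡ 1ℤ → dot x u ≡ 0ℤ → ∃ λ i → x i ≡ 0ℤ
orthogonal-to-unit x u ‖u‖²≡1 x·u≡0 with norm≡1⇒unit u ‖u‖²≡1
... | i , uᵢ≢0 , u≡0 = i , [ id , ⊥-elim ∘ uᵢ≢0 ]′ (ℤ.i*j≡0⇒i≡0∨j≡0 (x i) xᵢuᵢ≡0)
  where
  xᵢuᵢ≡0 : x i * u i ≡ 0ℤ
  xᵢuᵢ≡0 = trans (sym (sum-single (λ l → x l * u l) i λ l l≢i → trans (cong (x l *_) (u≡0 l l≢i)) (ℤ.*-zeroʳ (x l))))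
                 x·u≡0

-- Divisibility

module _ {p : ℕ} (p-prime : Prime p) where
  private instance
    p≢0 : NonZero p
    p≢0 = prime⇒nonZero p-prime

  ∣-*-prime : ∀ a b → (+ p) ∣ a * b → (+ p) ∣ a ⊎ (+ p) ∣ b
  ∣-*-prime a b p∣ab with euclidsLemma ℤ.∣ a ∣ ℤ.∣ b ∣ p-prime (subst (p ℕ.∣_) (ℤ.abs-* a b) (∣⇒∣ᵤ p∣ab))
  ... | inj₁ p∣a = inj₁ (∣ᵤ⇒∣ p∣a)
  ... | inj₂ p∣b = inj₂ (∣ᵤ⇒∣ p∣b)

  ∣-*-∤ˡ : ∀ {a b} → ¬ (+ p) ∣ a → (+ p) ∣ a * b → (+ p) ∣ b
  ∣-*-∤ˡ {a} {b} p∤a p∣ab with ∣-*-prime a b p∣ab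
  ... | inj₁ p∣a = ⊥-elim (p∤a p∣a)
  ... | inj₂ p∣b = p∣b

  ∤-* : ∀ {a b} → ¬ (+ p) ∣ a → ¬ (+ p) ∣ b → ¬ (+ p) ∣ a * b
  ∤-* p∤a p∤b p∣ab = p∤b (∣-*-∤ˡ p∤a p∣ab)

  ∣²-*-∤ˡ : ∀ {a d} → ¬ (+ p) ∣ a → (+ p * + p) ∣ a * d → (+ p * + p) ∣ d
  ∣²-*-∤ˡ {a} {d} p∤a p²∣ad = divides s (begin
    d                 ≡⟨ d≡q·p ⟩
    q * + p           ≡⟨ cong (_* + p) q≡s·p ⟩
    s * + p * + p     ≡⟨ ℤ.*-assoc s (+ p) (+ p) ⟩
    s * (+ p * + p)   ∎)
    where
    open ≡-Reasoning
    p∣d : (+ p) ∣ d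
    p∣d = ∣-*-∤ˡ p∤a (∣-trans (∣m⇒∣m*n (+ p) ∣-refl) p²∣ad)
    open _∣_ p∣d renaming (quotient to q; equality to d≡q·p)
    p∣q : (+ p) ∣ q
    p∣q = ∣-*-∤ˡ p∤a (*-cancelʳ-∣ (+ p) (subst (λ x → (+ p * + p) ∣ x) ad≡aq·p p²∣ad))
      where
      ad≡aq·p : a * d ≡ a * q * + p
      ad≡aq·p = trans (cong (a *_) d≡q·p) (sym (ℤ.*-assoc a q (+ p)))
    open _∣_ p∣q renaming (quotient to s; equality to q≡s·p)

<∧∣⇒≡0 : ∀ {p d} → d < p → p ℕ.∣ d → d ≡ 0
<∧∣⇒≡0 {d = zero}  _   _   = refl
<∧∣⇒≡0 {d = suc d} d<p p∣d = ⊥-elim (ℕ.>⇒∤ d<p p∣d)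

residues-injective : ∀ {p a b} → a < p → b < p → (+ p) ∣ + a - + b → a ≡ b
residues-injective {p} {a} {b} a<p b<p p∣a-b =
  ℤ.+-injective (ℤ.i-j≡0⇒i≡j (+ a) (+ b) (ℤ.∣i∣≡0⇒i≡0 (<∧∣⇒≡0 ∣a-b∣<p (∣⇒∣ᵤ p∣a-b))))
  where
  ∣a-b∣<p : ℤ.∣ + a - + b ∣ < p
  ∣a-b∣<p = ℕ.≤-<-trans (subst (ℕ._≤ a ⊔ b) (cong ℤ.∣_∣ (sym (ℤ.m-n≡m⊖n a b))) (ℤ.∣m⊝n∣≤m⊔n a b))
                         (ℕ.⊔-pres-<m a<p b<p)

∣-residue : ∀ c p .{{_ : NonZero p}} → (+ p) ∣ c - + (c ℤ.%ℕ p)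
∣-residue c p = divides (c ℤ./ℕ p) (trans (cong (_- + (c ℤ.%ℕ p)) (a≡a%ℕn+[a/ℕn]*n c p)) (cancel (+ (c ℤ.%ℕ p)) _))
  where
  cancel : ∀ r q → r + q - r ≡ q
  cancel = solve-∀

-- Perfect representatives

i*i-positive : ∀ i .{{_ : ℤ.NonZero i}} → ℤ.Positive (i * i)
i*i-positive +[1+ n ] = _
i*i-positive -[1+ n ] = _

orthogonal-or-equal : ∀ {m N} .{{_ : ℤ.Positive N}} {w x : Fin m → ℤ} →
                      dot w w ≡ N → dot x x ≡ N → N ∣ dot w x →
                      sumℤ w ≡ sumℤ x → sumℤ w ≢ 0ℤ → dot w x ≡ 0ℤ ⊎ (∀ i → w i ≡ x i)
orthogonal-or-equal {m} {N} {w} {x} ‖w‖²≡N ‖x‖²≡N (divides t w·x≡tN) Σw≡Σx Σw≢0 = by-cases t refl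
  where
  open ≡-Reasoning
  combination : ∀ a b (y : Fin m → ℤ) → (∀ i → y i ≡ a * w i + b * x i) →
                dot y y ≡ (a * a + b * b + + 2 * a * b * t) * N
  combination a b y y≡ = begin
    dot y y                                                  ≡⟨ dot-expand a b w x y y≡ ⟩
    a * a * dot w w + + 2 * a * b * dot w x + b * b * dot x x
      ≡⟨ cong₂ (λ u v → a * a * u + + 2 * a * b * dot w x + b * b * v) ‖w‖²≡N ‖x‖²≡N ⟩
    a * a * N + + 2 * a * b * dot w x + b * b * N
      ≡⟨ cong (λ u → a * a * N + + 2 * a * b * u + b * b * N) w·x≡tN ⟩
    a * a * N + + 2 * a * b * (t * N) + b * b * N            ≡⟨ collect a b t N ⟩
    (a * a + b * b + + 2 * a * b * t) * N                    ∎
    where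
    collect : ∀ a b t N → a * a * N + + 2 * a * b * (t * N) + b * b * N ≡ (a * a + b * b + + 2 * a * b * t) * N
    collect = solve-∀

  w-x w+x : Fin m → ℤ
  w-x i = w i - x i
  w+x i = w i + x i
  ‖w-x‖² : dot w-x w-x ≡ + 2 * (1ℤ - t) * N
  ‖w-x‖² = trans (combination 1ℤ -1ℤ w-x (λ i → lemma (w i) (x i))) (cong (_* N) (coefficient t))
    where
    lemma : ∀ a b → a - b ≡ 1ℤ * a + -1ℤ * b
    lemma = solve-∀
    coefficient : ∀ t → 1ℤ * 1ℤ + -1ℤ * -1ℤ + + 2 * 1ℤ * -1ℤ * t ≡ + 2 * (1ℤ - t)
    coefficient = solve-∀
  -- t - -1ℤ rather than 1ℤ + t, so that nonnegativity reads -1ℤ ≤ t through 0≤i-j⇒j≤i.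
  ‖w+x‖² : dot w+x w+x ≡ + 2 * (t - -1ℤ) * N
  ‖w+x‖² = trans (combination 1ℤ 1ℤ w+x (λ i → lemma (w i) (x i))) (cong (_* N) (coefficient t))
    where
    lemma : ∀ a b → a + b ≡ 1ℤ * a + 1ℤ * b
    lemma = solve-∀
    coefficient : ∀ t → 1ℤ * 1ℤ + 1ℤ * 1ℤ + + 2 * 1ℤ * 1ℤ * t ≡ + 2 * (t - -1ℤ)
    coefficient = solve-∀
  coefficient-nonneg : ∀ (y : Fin m → ℤ) c → dot y y ≡ + 2 * c * N → 0ℤ ℤ.≤ c
  coefficient-nonneg y c ‖y‖²≡2cN = ℤ.*-cancelˡ-≤-pos 0ℤ c (+ 2)
    (ℤ.*-cancelʳ-≤-pos 0ℤ (+ 2 * c) N (subst (λ x → 0ℤ ℤ.≤ x) ‖y‖²≡2cN (dot-self-nonneg y)))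
  t≤1 : t ℤ.≤ 1ℤ
  t≤1 = ℤ.0≤i-j⇒j≤i (coefficient-nonneg w-x (1ℤ - t) ‖w-x‖²)
  -1≤t : -1ℤ ℤ.≤ t
  -1≤t = ℤ.0≤i-j⇒j≤i (coefficient-nonneg w+x (t - -1ℤ) ‖w+x‖²)
  vanishes : ∀ (y : Fin m → ℤ) c → dot y y ≡ c * N → c ≡ 0ℤ → ∀ i → y i ≡ 0ℤ
  vanishes y c ‖y‖²≡cN c≡0 = dot-self≡0 y (trans ‖y‖²≡cN (trans (cong (_* N) c≡0) (ℤ.*-zeroˡ N)))

  by-cases : ∀ s → s ≡ t → dot w x ≡ 0ℤ ⊎ (∀ i → w i ≡ x i)
  by-cases +0 refl = inj₁ (trans w·x≡tN (ℤ.*-zeroˡ N))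
  by-cases +[1+ 0 ] refl = inj₂ λ i → ℤ.i-j≡0⇒i≡j (w i) (x i) (vanishes w-x _ ‖w-x‖² refl i)
  by-cases +[1+ suc n ] refl with +≤+ (ℕ.s≤s ()) ← t≤1
  by-cases -[1+ 0 ] refl = ⊥-elim (Σw≢0 Σw≡0)
    where
    Σw≡0 : sumℤ w ≡ 0ℤ
    Σw≡0 = ℤ.*-cancelˡ-≡ (+ 2) (sumℤ w) 0ℤ (begin
      + 2 * sumℤ w          ≡⟨ two-times (sumℤ w) ⟩
      sumℤ w + sumℤ w       ≡⟨ cong (λ s → sumℤ w + s) Σw≡Σx ⟩
      sumℤ w + sumℤ x       ≡⟨ sum-+ w x ⟨
      sumℤ w+x              ≡⟨ sum-≡0 (vanishes w+x _ ‖w+x‖² refl) ⟩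
      0ℤ                    ∎)
      where
      two-times : ∀ a → + 2 * a ≡ a + a
      two-times = solve-∀
  by-cases -[1+ suc n ] refl with ℤ.-≤- () ← -1≤t

record IsPerfectRep {m : ℕ} (p : ℕ) (u w : Fin m → ℤ) : Set where
  field
    congruent : ∀ i → (+ p) ∣ w i - u i
    sum≡p     : sumℤ w ≡ + p
    norm≡p²   : dot w w ≡ + p * + p

IsPerfectRep-cong : ∀ {m p} {u w w′ : Fin m → ℤ} → (∀ i → w i ≡ w′ i) → IsPerfectRep p u w → IsPerfectRep p u w′
IsPerfectRep-cong {p = p} {u} {w} {w′} w≗w′ rep = record
  { congruent = λ i → subst (λ x → (+ p) ∣ x - u i) (w≗w′ i) (congruent i)
  ; sum≡p     = trans (sym (sum-cong w≗w′)) sum≡p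
  ; norm≡p²   = trans (sym (sum-cong λ i → cong₂ _*_ (w≗w′ i) (w≗w′ i))) norm≡p²
  }
  where open IsPerfectRep rep

module _ {p : ℕ} (p-prime : Prime p) (p≢2 : p ≢ 2) where
  private instance
    p≢0 : NonZero p
    p≢0 = prime⇒nonZero p-prime

  p∤2 : ¬ (+ p) ∣ + 2
  p∤2 p∣2 = ℕ.>⇒∤ 2<p (∣⇒∣ᵤ p∣2)
    where
    2<p : 2 ℕ.< p
    2<p = ℕ.≤∧≢⇒< (ℕ.nonTrivial⇒n>1 p {{prime⇒nonTrivial p-prime}}) (p≢2 ∘ sym)

  p²∣dot : ∀ {m a b} {w x : Fin m → ℤ} → ¬ (+ p) ∣ a → ¬ (+ p) ∣ b →
           (∀ i → (+ p) ∣ a * w i - b * x i) →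
           (+ p * + p) ∣ dot w w → (+ p * + p) ∣ dot x x → (+ p * + p) ∣ dot w x
  p²∣dot {m} {a} {b} {w} {x} p∤a p∤b p∣y p²∣‖w‖² p²∣‖x‖² =
    ∣²-*-∤ˡ p-prime (∤-* p-prime (∤-* p-prime p∤2 p∤a) p∤b) (subst ((+ p * + p) ∣_) (sym 2ab[w·x]≡) p²∣rhs)
    where
    y z : Fin m → ℤ
    y i = a * w i - b * x i
    z i = _∣_.quotient (p∣y i)
    y≡zp : ∀ i → y i ≡ z i * + p
    y≡zp i = _∣_.equality (p∣y i)
    ‖y‖²≡ : dot y y ≡ dot z z * (+ p * + p)
    ‖y‖²≡ = trans (sum-cong λ i → trans (cong₂ _*_ (y≡zp i) (y≡zp i)) (square (z i) (+ p)))
                  (sum-*ʳ (+ p * + p) (λ i → z i * z i))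
      where
      square : ∀ z p → z * p * (z * p) ≡ z * z * (p * p)
      square = solve-∀
    2ab[w·x]≡ : + 2 * a * b * dot w x ≡ a * a * dot w w + - b * - b * dot x x - dot y y
    2ab[w·x]≡ = trans (rearrange a b (dot w w) (dot w x) (dot x x))
      (cong (λ s → a * a * dot w w + - b * - b * dot x x - s)
            (sym (dot-expand a (- b) w x y (λ i → minus (a * w i) b (x i)))))
      where
      rearrange : ∀ a b W D X → + 2 * a * b * D
                              ≡ a * a * W + - b * - b * X - (a * a * W + + 2 * a * - b * D + - b * - b * X)
      rearrange = solve-∀
      minus : ∀ u b v → u - b * v ≡ u + - b * v
      minus = solve-∀
    p²∣rhs : (+ p * + p) ∣ a * a * dot w w + - b * - b * dot x x - dot y y
    p²∣rhs = ∣m∣n⇒∣m-n (∣m∣n⇒∣m+n (∣n⇒∣m*n (a * a) p²∣‖w‖²) (∣n⇒∣m*n (- b * - b) p²∣‖x‖²)) (divides (dot z z) ‖y‖²≡)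

  perfectReps-orthogonal-or-equal :
    ∀ {m} {v w x : Fin m → ℤ} {c c′} → ¬ (+ p) ∣ c → ¬ (+ p) ∣ c′ →
    IsPerfectRep p (λ i → c * v i) w → IsPerfectRep p (λ i → c′ * v i) x →
    dot w x ≡ 0ℤ ⊎ (∀ i → w i ≡ x i)
  perfectReps-orthogonal-or-equal {v = v} {w} {x} {c} {c′} p∤c p∤c′ w-rep x-rep =
    orthogonal-or-equal {{i*i-positive (+ p)}} W.norm≡p² X.norm≡p²
      (p²∣dot p∤c′ p∤c p∣c′w-cx (∣-reflexive (sym W.norm≡p²)) (∣-reflexive (sym X.norm≡p²)))
      (trans W.sum≡p (sym X.sum≡p)) Σw≢0
    where
    module W = IsPerfectRep w-rep
    module X = IsPerfectRep x-rep
    p∣c′w-cx : ∀ i → (+ p) ∣ c′ * w i - c * x i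
    p∣c′w-cx i = subst ((+ p) ∣_) (lemma c c′ (w i) (x i) (v i))
      (∣m∣n⇒∣m-n (∣n⇒∣m*n c′ (W.congruent i)) (∣n⇒∣m*n c (X.congruent i)))
      where
      lemma : ∀ c c′ w x v → c′ * (w - c * v) - c * (x - c′ * v) ≡ c′ * w - c * x
      lemma = solve-∀
    Σw≢0 : sumℤ w ≢ 0ℤ
    Σw≢0 Σw≡0 = ℕ.≢-nonZero⁻¹ p (ℤ.+-injective (trans (sym W.sum≡p) Σw≡0))

-- Integer matrices with orthogonal columns

-- A square integer matrix is given by its columns: W j i is the entry in row i and column j.

module _ {m : ℕ} where

  rowSum : (Fin m → Fin m → ℤ) → Fin m → ℤ
  rowSum W i = sumℤ (λ j → W j i)

  record OrthogonalColumns (N : ℤ) (W : Fin m → Fin m → ℤ) : Set where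
    field
      norm       : ∀ j → dot (W j) (W j) ≡ N
      orthogonal : ∀ j l → j ≢ l → dot (W j) (W l) ≡ 0ℤ

  sum-dot-columns : (W : Fin m → Fin m → ℤ) (u : Fin m → ℤ) → sumℤ (λ j → dot u (W j)) ≡ dot u (rowSum W)
  sum-dot-columns W u = begin
    sumℤ (λ j → sumℤ (λ i → u i * W j i))  ≡⟨ sum-swap (λ i j → u i * W j i) ⟨
    sumℤ (λ i → sumℤ (λ j → u i * W j i))  ≡⟨ sum-cong (λ i → sum-*ˡ (u i) (λ j → W j i)) ⟩
    sumℤ (λ i → u i * rowSum W i)          ∎
    where open ≡-Reasoning

  module _ {N : ℤ} {W : Fin m → Fin m → ℤ} (cols : OrthogonalColumns N W) where
    open OrthogonalColumns cols

    dot-rowSum : ∀ j → dot (W j) (rowSum W) ≡ N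
    dot-rowSum j = begin
      dot (W j) (rowSum W)           ≡⟨ sum-dot-columns W (W j) ⟨
      sumℤ (λ l → dot (W j) (W l))   ≡⟨ sum-single _ j (λ l l≢j → orthogonal j l (l≢j ∘ sym)) ⟩
      dot (W j) (W j)                ≡⟨ norm j ⟩
      N                              ∎
      where open ≡-Reasoning

    columnSums≡ : ∀ {P} .{{_ : ℤ.NonZero P}} → N ≡ P * P → (∀ i → rowSum W i ≡ P) → ∀ j → sumℤ (W j) ≡ P
    columnSums≡ {P} N≡P² rows j = ℤ.*-cancelʳ-≡ (sumℤ (W j)) P P (begin
      sumℤ (W j) * P               ≡⟨ sum-*ʳ P (W j) ⟨
      sumℤ (λ i → W j i * P)       ≡⟨ sum-cong (λ i → cong (W j i *_) (rows i)) ⟨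
      dot (W j) (rowSum W)         ≡⟨ dot-rowSum j ⟩
      N                            ≡⟨ N≡P² ⟩
      P * P                        ∎)
      where open ≡-Reasoning

    rowSums≡ : ∀ {P} → N ≡ P * P → (∀ j → sumℤ (W j) ≡ P) → ∀ i → rowSum W i ≡ P
    rowSums≡ {P} N≡P² colSums i = ℤ.i-j≡0⇒i≡j (R i) P (dot-self≡0 R-P ‖R-P‖²≡0 i)
      where
      open ≡-Reasoning
      R 𝟙 R-P : Fin m → ℤ
      R = rowSum W
      𝟙 _ = 1ℤ
      R-P i = R i - P
      ‖R‖² : dot R R ≡ + m * N
      ‖R‖² = begin
        dot R R                      ≡⟨ sum-dot-columns W R ⟨
        sumℤ (λ j → dot R (W j))     ≡⟨ sum-cong (λ j → trans (dot-comm R (W j)) (dot-rowSum j)) ⟩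
        sumℤ {m} (λ _ → N)           ≡⟨ sum-const m N ⟩
        + m * N                      ∎
      R·𝟙 : dot R 𝟙 ≡ + m * P
      R·𝟙 = begin
        sumℤ (λ i → R i * 1ℤ)            ≡⟨ sum-cong (λ i → ℤ.*-identityʳ (R i)) ⟩
        sumℤ (λ i → sumℤ (λ j → W j i))  ≡⟨ sum-swap (λ i j → W j i) ⟩
        sumℤ (λ j → sumℤ (W j))          ≡⟨ sum-cong colSums ⟩
        sumℤ {m} (λ _ → P)               ≡⟨ sum-const m P ⟩
        + m * P                          ∎
      ‖R-P‖²≡0 : dot R-P R-P ≡ 0ℤ
      ‖R-P‖²≡0 = begin
        dot R-P R-P
          ≡⟨ dot-expand 1ℤ (- P) R 𝟙 R-P (λ i → minus (R i) P) ⟩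
        1ℤ * 1ℤ * dot R R + + 2 * 1ℤ * - P * dot R 𝟙 + - P * - P * dot 𝟙 𝟙
          ≡⟨ cong₂ (λ x y → 1ℤ * 1ℤ * x + + 2 * 1ℤ * - P * y + - P * - P * dot 𝟙 𝟙)
                   (trans ‖R‖² (cong (+ m *_) N≡P²)) R·𝟙 ⟩
        1ℤ * 1ℤ * (+ m * (P * P)) + + 2 * 1ℤ * - P * (+ m * P) + - P * - P * dot 𝟙 𝟙
          ≡⟨ cong (λ x → 1ℤ * 1ℤ * (+ m * (P * P)) + + 2 * 1ℤ * - P * (+ m * P) + - P * - P * x)
                  (trans (sum-const m 1ℤ) (ℤ.*-identityʳ (+ m))) ⟩
        1ℤ * 1ℤ * (+ m * (P * P)) + + 2 * 1ℤ * - P * (+ m * P) + - P * - P * + m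
          ≡⟨ vanishes (+ m) P ⟩
        0ℤ ∎
        where
        minus : ∀ r P → r - P ≡ 1ℤ * r + - P * 1ℤ
        minus = solve-∀
        vanishes : ∀ m P → 1ℤ * 1ℤ * (m * (P * P)) + + 2 * 1ℤ * - P * (m * P) + - P * - P * m ≡ 0ℤ
        vanishes = solve-∀

    divisible-column⇒zero-entry : ∀ {P j j′} .{{_ : ℤ.NonZero P}} → N ≡ P * P →
                                  (∀ i → P ∣ W j i) → j′ ≢ j → ∃ λ i → W j′ i ≡ 0ℤ
    divisible-column⇒zero-entry {P} {j} {j′} N≡P² P∣W j′≢j = orthogonal-to-unit (W j′) u ‖u‖²≡1 W′·u≡0
      where
      open ≡-Reasoning
      u : Fin m → ℤ
      u i = _∣_.quotient (P∣W i)
      W≡uP : ∀ i → W j i ≡ u i * P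
      W≡uP i = _∣_.equality (P∣W i)
      ‖u‖²≡1 : dot u u ≡ 1ℤ
      ‖u‖²≡1 = ℤ.*-cancelʳ-≡ (dot u u) 1ℤ (P * P) {{ℤ.i*j≢0 P P}} (begin
        dot u u * (P * P)                       ≡⟨ sum-*ʳ (P * P) (λ i → u i * u i) ⟨
        sumℤ (λ i → u i * u i * (P * P))
          ≡⟨ sum-cong (λ i → trans (cong₂ _*_ (W≡uP i) (W≡uP i)) (square (u i) P)) ⟨
        dot (W j) (W j)                         ≡⟨ trans (norm j) N≡P² ⟩
        P * P                                   ≡⟨ ℤ.*-identityˡ (P * P) ⟨
        1ℤ * (P * P)                            ∎)
        where
        square : ∀ a P → a * P * (a * P) ≡ a * a * (P * P)
        square = solve-∀
      W′·u≡0 : dot (W j′) u ≡ 0ℤ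
      W′·u≡0 = ℤ.*-cancelʳ-≡ (dot (W j′) u) 0ℤ P (begin
        dot (W j′) u * P                        ≡⟨ sum-*ʳ P (λ i → W j′ i * u i) ⟨
        sumℤ (λ i → W j′ i * u i * P)
          ≡⟨ sum-cong (λ i → trans (cong (W j′ i *_) (W≡uP i)) (sym (ℤ.*-assoc (W j′ i) (u i) P))) ⟨
        dot (W j′) (W j)                        ≡⟨ orthogonal j′ j j′≢j ⟩
        0ℤ                                      ∎)

-- Rational matrices with denominator p

ι : ℤ → ℚ
ι z = z ℚ./ 1

toℚᵘ-ι : ∀ a → toℚᵘ (ι a) ≃ᵘ mkℚᵘ a 0
toℚᵘ-ι a = ℚ.toℚᵘ-fromℚᵘ (mkℚᵘ a 0)

ι-injective : ∀ {a b} → ι a ≡ ι b → a ≡ b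
ι-injective {a} {b} ιa≡ιb with ℚ.fromℚᵘ-injective {mkℚᵘ a 0} {mkℚᵘ b 0} ιa≡ιb
... | *≡* a*1≡b*1 = trans (sym (ℤ.*-identityʳ a)) (trans a*1≡b*1 (ℤ.*-identityʳ b))

ι-+ : ∀ a b → ι (a + b) ≡ ι a ℚ.+ ι b
ι-+ a b = ℚ.toℚᵘ-injective (begin
  toℚᵘ (ι (a + b))             ≈⟨ toℚᵘ-ι (a + b) ⟩
  mkℚᵘ (a + b) 0               ≈⟨ *≡* (lemma a b) ⟩
  mkℚᵘ a 0 ℚᵘ.+ mkℚᵘ b 0       ≈⟨ ℚᵘ.+-cong (toℚᵘ-ι a) (toℚᵘ-ι b) ⟨
  toℚᵘ (ι a) ℚᵘ.+ toℚᵘ (ι b)   ≈⟨ ℚ.toℚᵘ-homo-+ (ι a) (ι b) ⟨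
  toℚᵘ (ι a ℚ.+ ι b)           ∎)
  where
  open ℚᵘ.≃-Reasoning
  lemma : ∀ a b → (a + b) * 1ℤ ≡ (a * 1ℤ + b * 1ℤ) * 1ℤ
  lemma = solve-∀

ι-* : ∀ a b → ι (a * b) ≡ ι a ℚ.* ι b
ι-* a b = ℚ.toℚᵘ-injective (begin
  toℚᵘ (ι (a * b))             ≈⟨ toℚᵘ-ι (a * b) ⟩
  mkℚᵘ a 0 ℚᵘ.* mkℚᵘ b 0       ≈⟨ ℚᵘ.*-cong (toℚᵘ-ι a) (toℚᵘ-ι b) ⟨
  toℚᵘ (ι a) ℚᵘ.* toℚᵘ (ι b)   ≈⟨ ℚ.toℚᵘ-homo-* (ι a) (ι b) ⟨
  toℚᵘ (ι a ℚ.* ι b)           ∎)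
  where open ℚᵘ.≃-Reasoning

sumℚ-cong : ∀ {m} {f g : Fin m → ℚ} → (∀ i → f i ≡ g i) → sumℚ f ≡ sumℚ g
sumℚ-cong {zero}  f≗g = refl
sumℚ-cong {suc m} f≗g = cong₂ ℚ._+_ (f≗g zero) (sumℚ-cong (f≗g ∘ suc))

sumℚ-*ʳ : ∀ {m} (c : ℚ) (f : Fin m → ℚ) → sumℚ (λ i → f i ℚ.* c) ≡ sumℚ f ℚ.* c
sumℚ-*ʳ {zero}  c f = sym (ℚ.*-zeroˡ c)
sumℚ-*ʳ {suc m} c f = trans (cong (f zero ℚ.* c ℚ.+_) (sumℚ-*ʳ c (f ∘ suc))) (sym (ℚ.*-distribʳ-+ c (f zero) _))

sumℚ-ι : ∀ {m} (f : Fin m → ℤ) → sumℚ (ι ∘ f) ≡ ι (sumℤ f)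
sumℚ-ι {zero}  f = refl
sumℚ-ι {suc m} f = trans (cong (ι (f zero) ℚ.+_) (sumℚ-ι (f ∘ suc))) (sym (ι-+ (f zero) _))

module _ (p : ℕ) .{{_ : NonZero p}} where

  ι[p]≢0 : ι (+ p) ≢ 0ℚ
  ι[p]≢0 ι[p]≡0 = ℕ.≢-nonZero⁻¹ p (ℤ.+-injective (ι-injective ι[p]≡0))

  private instance
    ι[p]-nonZero : ℚ.NonZero (ι (+ p))
    ι[p]-nonZero = ℚ.≢-nonZero ι[p]≢0

  p⁻¹ : ℚ
  p⁻¹ = 1/ ι (+ p)

  p*[x*p⁻¹]≡x : ∀ x → ι (+ p) ℚ.* (x ℚ.* p⁻¹) ≡ x
  p*[x*p⁻¹]≡x x = begin
    ι (+ p) ℚ.* (x ℚ.* p⁻¹)  ≡⟨ cong (ι (+ p) ℚ.*_) (ℚ.*-comm x p⁻¹) ⟩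
    ι (+ p) ℚ.* (p⁻¹ ℚ.* x)  ≡⟨ ℚ.*-assoc (ι (+ p)) p⁻¹ x ⟨
    ι (+ p) ℚ.* p⁻¹ ℚ.* x    ≡⟨ cong (ℚ._* x) (ℚ.*-inverseʳ (ι (+ p))) ⟩
    1ℚ ℚ.* x                 ≡⟨ ℚ.*-identityˡ x ⟩
    x                        ∎
    where open ≡-Reasoning

  x*p⁻¹≡y⇒x≡p*y : ∀ {x y} → x ℚ.* p⁻¹ ≡ y → x ≡ ι (+ p) ℚ.* y
  x*p⁻¹≡y⇒x≡p*y {x} x*p⁻¹≡y = trans (sym (p*[x*p⁻¹]≡x x)) (cong (ι (+ p) ℚ.*_) x*p⁻¹≡y)

  x≡p*y⇒x*p⁻¹≡y : ∀ {x y} → x ≡ ι (+ p) ℚ.* y → x ℚ.* p⁻¹ ≡ y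
  x≡p*y⇒x*p⁻¹≡y {x} {y} x≡p*y = begin
    x ℚ.* p⁻¹                  ≡⟨ cong (ℚ._* p⁻¹) x≡p*y ⟩
    ι (+ p) ℚ.* y ℚ.* p⁻¹      ≡⟨ ℚ.*-assoc (ι (+ p)) y p⁻¹ ⟩
    ι (+ p) ℚ.* (y ℚ.* p⁻¹)    ≡⟨ p*[x*p⁻¹]≡x y ⟩
    y                          ∎
    where open ≡-Reasoning

  ι*p⁻¹≡ι⇔ : ∀ {a b} → ι a ℚ.* p⁻¹ ≡ ι b ⇔ a ≡ + p * b
  ι*p⁻¹≡ι⇔ {a} {b} = mk⇔
    (λ eq → ι-injective (trans (x*p⁻¹≡y⇒x≡p*y eq) (sym (ι-* (+ p) b))))
    (λ eq → x≡p*y⇒x*p⁻¹≡y (trans (cong ι eq) (ι-* (+ p) b)))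

  ι*p⁻¹*p⁻¹≡ι⇔ : ∀ {a b} → ι a ℚ.* p⁻¹ ℚ.* p⁻¹ ≡ ι b ⇔ a ≡ + p * (+ p * b)
  ι*p⁻¹*p⁻¹≡ι⇔ {a} {b} = mk⇔
    (λ eq → Equivalence.to ι*p⁻¹≡ι⇔ (trans (x*p⁻¹≡y⇒x≡p*y eq) (sym (ι-* (+ p) b))))
    (λ eq → x≡p*y⇒x*p⁻¹≡y (trans (Equivalence.from ι*p⁻¹≡ι⇔ eq) (ι-* (+ p) b)))

↥-ι : ∀ a → ℚ.↥ (ι a) ≡ a
↥-ι (+ n)      = cong ℚ.↥_ (ℚ.normalize-coprime (Coprime.sym (Coprime.1-coprimeTo n)))
↥-ι ℤ.-[1+ n ] = cong (ℚ.↥_ ∘ ℚ.-_) (ℚ.normalize-coprime (Coprime.sym (Coprime.1-coprimeTo (suc n))))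

δ-refl : ∀ {m} (i : Fin m) → δ i i ≡ 1ℚ
δ-refl zero    = refl
δ-refl (suc i) = δ-refl i

δ-≢ : ∀ {m} {i j : Fin m} → i ≢ j → δ i j ≡ 0ℚ
δ-≢ {i = zero}  {zero}  i≢j = ⊥-elim (i≢j refl)
δ-≢ {i = zero}  {suc j} i≢j = refl
δ-≢ {i = suc i} {zero}  i≢j = refl
δ-≢ {i = suc i} {suc j} i≢j = δ-≢ (i≢j ∘ cong suc)

module _ (p : ℕ) .{{_ : NonZero p}} {m : ℕ} (W : Fin m → Fin m → ℤ) (Q : Matrix m)
         (Q≡W/p : ∀ i j → Q i j ≡ ι (W j i) ℚ.* p⁻¹ p) where

  private
    r : ℚ
    r = p⁻¹ p

  gram : ∀ i j → sumℚ (λ k → Q k i ℚ.* Q k j) ≡ ι (dot (W i) (W j)) ℚ.* r ℚ.* r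
  gram i j = begin
    sumℚ (λ k → Q k i ℚ.* Q k j)                     ≡⟨ sumℚ-cong entry ⟩
    sumℚ (λ k → ι (W i k * W j k) ℚ.* (r ℚ.* r))     ≡⟨ sumℚ-*ʳ (r ℚ.* r) (λ k → ι (W i k * W j k)) ⟩
    sumℚ (λ k → ι (W i k * W j k)) ℚ.* (r ℚ.* r)     ≡⟨ cong (ℚ._* (r ℚ.* r)) (sumℚ-ι (λ k → W i k * W j k)) ⟩
    ι (dot (W i) (W j)) ℚ.* (r ℚ.* r)                ≡⟨ ℚ.*-assoc (ι (dot (W i) (W j))) r r ⟨
    ι (dot (W i) (W j)) ℚ.* r ℚ.* r                  ∎
    where
    open ≡-Reasoning
    entry : ∀ k → Q k i ℚ.* Q k j ≡ ι (W i k * W j k) ℚ.* (r ℚ.* r)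
    entry k = begin
      Q k i ℚ.* Q k j                                ≡⟨ cong₂ ℚ._*_ (Q≡W/p k i) (Q≡W/p k j) ⟩
      (ι (W i k) ℚ.* r) ℚ.* (ι (W j k) ℚ.* r)        ≡⟨ interchange (ι (W i k)) r (ι (W j k)) r ⟩
      (ι (W i k) ℚ.* ι (W j k)) ℚ.* (r ℚ.* r)        ≡⟨ cong (ℚ._* (r ℚ.* r)) (ι-* (W i k) (W j k)) ⟨
      ι (W i k * W j k) ℚ.* (r ℚ.* r)                ∎

  rowSumℚ : ∀ i → sumℚ (Q i) ≡ ι (rowSum W i) ℚ.* r
  rowSumℚ i = begin
    sumℚ (Q i)                            ≡⟨ sumℚ-cong (Q≡W/p i) ⟩
    sumℚ (λ j → ι (W j i) ℚ.* r)          ≡⟨ sumℚ-*ʳ r (λ j → ι (W j i)) ⟩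
    sumℚ (λ j → ι (W j i)) ℚ.* r          ≡⟨ cong (ℚ._* r) (sumℚ-ι (λ j → W j i)) ⟩
    ι (rowSum W i) ℚ.* r                  ∎
    where open ≡-Reasoning

  orthogonal⇔orthogonalColumns : Orthogonal Q ⇔ OrthogonalColumns (+ p * + p) W
  orthogonal⇔orthogonalColumns = mk⇔ orthogonal⇒ ⇒orthogonal
    where
    gram≡ι⇔ : ∀ {i j} b → sumℚ (λ k → Q k i ℚ.* Q k j) ≡ ι b ⇔ dot (W i) (W j) ≡ + p * (+ p * b)
    gram≡ι⇔ {i} {j} b = mk⇔
      (λ Σ≡ → Equivalence.to (ι*p⁻¹*p⁻¹≡ι⇔ p) (trans (sym (gram i j)) Σ≡))
      (λ d≡ → trans (gram i j) (Equivalence.from (ι*p⁻¹*p⁻¹≡ι⇔ p) d≡))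
    p*[p*1]≡p*p : + p * (+ p * 1ℤ) ≡ + p * + p
    p*[p*1]≡p*p = cong (+ p *_) (ℤ.*-identityʳ (+ p))
    p*[p*0]≡0 : + p * (+ p * 0ℤ) ≡ 0ℤ
    p*[p*0]≡0 = trans (cong (+ p *_) (ℤ.*-zeroʳ (+ p))) (ℤ.*-zeroʳ (+ p))

    orthogonal⇒ : Orthogonal Q → OrthogonalColumns (+ p * + p) W
    orthogonal⇒ orth = record
      { norm       = λ j → trans (Equivalence.to (gram≡ι⇔ 1ℤ) (trans (orth j j) (δ-refl j))) p*[p*1]≡p*p
      ; orthogonal = λ j l j≢l → trans (Equivalence.to (gram≡ι⇔ 0ℤ) (trans (orth j l) (δ-≢ j≢l))) p*[p*0]≡0
      }

    ⇒orthogonal : OrthogonalColumns (+ p * + p) W → Orthogonal Q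
    ⇒orthogonal cols i j with i ≟ j
    ... | yes refl = trans (Equivalence.from (gram≡ι⇔ 1ℤ) (trans (norm i) (sym p*[p*1]≡p*p))) (sym (δ-refl i))
      where open OrthogonalColumns cols
    ... | no i≢j = trans (Equivalence.from (gram≡ι⇔ 0ℤ) (trans (orthogonal i j i≢j) (sym p*[p*0]≡0))) (sym (δ-≢ i≢j))
      where open OrthogonalColumns cols

  regular⇔rowSums : Regular Q ⇔ (∀ i → rowSum W i ≡ + p)
  regular⇔rowSums = mk⇔
    (λ reg i → trans (Equivalence.to (ι*p⁻¹≡ι⇔ p) (trans (sym (rowSumℚ i)) (reg i))) (ℤ.*-identityʳ (+ p)))
    (λ rows i → trans (rowSumℚ i) (Equivalence.from (ι*p⁻¹≡ι⇔ p) (trans (rows i) (sym (ℤ.*-identityʳ (+ p))))))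

-- Counting

module _ {m : ℕ} where

  HasCard-unique : ∀ {P P′ : Vec ℤ m → Set} {a b} → HasCard P a → HasCard P′ b →
                   (∀ w → P w ⇔ P′ w) → a ≡ b
  HasCard-unique (L , L-unique , L⇔P , ∣L∣≡a) (L′ , L′-unique , L′⇔P′ , ∣L′∣≡b) P⇔P′ =
    trans (sym ∣L∣≡a) (trans (↭-length (∼bag⇒↭ (unique∧set⇒bag L-unique L′-unique same-elements))) ∣L′∣≡b)
    where
    same-elements : ∀ {w} → w ∈ L ⇔ w ∈ L′
    same-elements {w} = ⇔.trans (L⇔P w) (⇔.trans (P⇔P′ w) (⇔.sym (L′⇔P′ w)))

  HasCard-image : ∀ {k} (f : Fin k → Vec ℤ m) → (∀ {i j} → f i ≡ f j → i ≡ j) →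
                  HasCard (λ w → ∃ λ i → w ≡ f i) k
  HasCard-image f f-injective =
    List.tabulate f , tabulate⁺ f-injective , (λ w → mk⇔ ∈-tabulate⁻ λ where (i , refl) → ∈-tabulate⁺ i)
    , length-tabulate f

  HasCard-⋃ : (R : ℕ → Vec ℤ m → Set) (n : ℕ → ℕ) (N : ℕ) →
              (∀ k → 1 ≤ k → k ≤ N → HasCard (R k) (n k)) →
              (∀ {k k′ w} → 1 ≤ k → k ≤ N → 1 ≤ k′ → k′ ≤ N → R k w → R k′ w → k ≡ k′) →
              HasCard (λ w → ∃ λ k → 1 ≤ k × k ≤ N × R k w) (sumTo N n)
  HasCard-⋃ R n zero card disjoint =
    [] , [] , (λ w → mk⇔ (λ ()) λ where (k , 1≤k , k≤0 , _) → contradiction (ℕ.≤-trans 1≤k k≤0) λ ()) , refl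
  HasCard-⋃ R n (suc N) card disjoint
    with HasCard-⋃ R n N (λ k 1≤k k≤N → card k 1≤k (ℕ.m≤n⇒m≤1+n k≤N))
           (λ 1≤k k≤N 1≤k′ k′≤N → disjoint 1≤k (ℕ.m≤n⇒m≤1+n k≤N) 1≤k′ (ℕ.m≤n⇒m≤1+n k′≤N))
       | card (suc N) (ℕ.s≤s ℕ.z≤n) ℕ.≤-refl
  ... | L , L-unique , L⇔ , ∣L∣≡ | L′ , L′-unique , L′⇔ , ∣L′∣≡ =
    L ++ L′ , ++⁺ L-unique L′-unique L#L′ , members , trans (length-++ L) (cong₂ ℕ._+_ ∣L∣≡ ∣L′∣≡)
    where
    L#L′ : ∀ {w} → w ∈ L × w ∈ L′ → ⊥
    L#L′ (w∈L , w∈L′) with Equivalence.to (L⇔ _) w∈L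
    ... | k , 1≤k , k≤N , Rkw =
      ℕ.<-irrefl (disjoint 1≤k (ℕ.m≤n⇒m≤1+n k≤N) (ℕ.s≤s ℕ.z≤n) ℕ.≤-refl Rkw (Equivalence.to (L′⇔ _) w∈L′)) (ℕ.s≤s k≤N)
    members : ∀ w → w ∈ L ++ L′ ⇔ (∃ λ k → 1 ≤ k × k ≤ suc N × R k w)
    members w = mk⇔ to from
      where
      to : w ∈ L ++ L′ → ∃ λ k → 1 ≤ k × k ≤ suc N × R k w
      to w∈ with ∈-++⁻ L w∈
      ... | inj₁ w∈L with Equivalence.to (L⇔ w) w∈L
      ...   | k , 1≤k , k≤N , Rkw = k , 1≤k , ℕ.m≤n⇒m≤1+n k≤N , Rkw
      to w∈ | inj₂ w∈L′ = suc N , ℕ.s≤s ℕ.z≤n , ℕ.≤-refl , Equivalence.to (L′⇔ w) w∈L′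
      from : (∃ λ k → 1 ≤ k × k ≤ suc N × R k w) → w ∈ L ++ L′
      from (k , 1≤k , k≤1+N , Rkw) with ℕ.m≤n⇒m<n∨m≡n k≤1+N
      ... | inj₁ k<1+N = ∈-++⁺ˡ (Equivalence.from (L⇔ w) (k , 1≤k , ℕ.s≤s⁻¹ k<1+N , Rkw))
      ... | inj₂ refl  = ∈-++⁺ʳ L (Equivalence.from (L′⇔ w) Rkw)

lookup-injective : ∀ {A : Set} {xs : List A} → Unique xs → ∀ i j → List.lookup xs i ≡ List.lookup xs j → i ≡ j
lookup-injective (_ ∷ _)       zero    zero    _ = refl
lookup-injective (x∉xs ∷ _)    zero    (suc j) x≡xⱼ = contradiction x≡xⱼ (All.lookup x∉xs (∈-lookup j))
lookup-injective (x∉xs ∷ _)    (suc i) zero    xᵢ≡x = contradiction (sym xᵢ≡x) (All.lookup x∉xs (∈-lookup i))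
lookup-injective (_ ∷ unique)  (suc i) (suc j) xᵢ≡xⱼ = cong suc (lookup-injective unique i j xᵢ≡xⱼ)

HasCard-resp-⇔ : ∀ {m} {P P′ : Vec ℤ m → Set} {n} → (∀ w → P w ⇔ P′ w) → HasCard P n → HasCard P′ n
HasCard-resp-⇔ P⇔P′ (L , L-unique , L⇔P , ∣L∣≡n) = L , L-unique , (λ w → ⇔.trans (L⇔P w) (P⇔P′ w)) , ∣L∣≡n

≤∸1⇔< : ∀ {k n} .{{_ : NonZero n}} → k ≤ n ∸ 1 ⇔ k < n
≤∸1⇔< {n = suc n} = mk⇔ ℕ.s≤s ℕ.s≤s⁻¹

-- Representatives of the multiples of v

module Representatives {p : ℕ} (p-prime : Prime p) (p≢2 : p ≢ 2) {m : ℕ} (v : Vec ℤ m)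
                       (p∤v : ∀ i → ¬ (+ p) ∣ lookup v i) where

  private instance
    p≢0 : NonZero p
    p≢0 = prime⇒nonZero p-prime

  p∤k : ∀ {k} → 1 ≤ k → k < p → ¬ (+ p) ∣ + k
  p∤k {suc k} _ k<p p∣k = ℕ.>⇒∤ k<p (∣⇒∣ᵤ p∣k)

  Reps : Vec ℤ m → Set
  Reps w = ∃ λ k → 1 ≤ k × k < p × PerfectRep p (k · v) w

  perfectRep⇔ : ∀ k w → PerfectRep p (k · v) w ⇔ IsPerfectRep p (λ i → + k * lookup v i) (lookup w)
  perfectRep⇔ k w = mk⇔
    (λ (w≡kv , Σw≡p , ‖w‖²≡p²) → record
      { congruent = λ i → subst (λ x → (+ p) ∣ lookup w i - x) (kv i) (∣ᵤ⇒∣ (w≡kv i))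
      ; sum≡p     = Σw≡p
      ; norm≡p²   = trans ‖w‖²≡p² (ℤ.pos-* p p) })
    (λ rep → let open IsPerfectRep rep in
      (λ i → ∣⇒∣ᵤ (subst (λ x → (+ p) ∣ lookup w i - x) (sym (kv i)) (congruent i)))
      , sum≡p , trans norm≡p² (sym (ℤ.pos-* p p)))
    where
    kv : ∀ i → lookup (k · v) i ≡ + k * lookup v i
    kv i = Vec.lookup-map i (+ k *_) v

  p∤entries : ∀ {c} {w : Fin m → ℤ} → ¬ (+ p) ∣ c → (∀ i → (+ p) ∣ w i - c * lookup v i) → ∀ i → ¬ (+ p) ∣ w i
  p∤entries {c} {w} p∤c w≡cv i p∣wᵢ =
    ∤-* p-prime p∤c (p∤v i) (subst ((+ p) ∣_) (lemma (w i) (c * lookup v i)) (∣m∣n⇒∣m-n p∣wᵢ (w≡cv i)))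
    where
    lemma : ∀ a b → a - (a - b) ≡ b
    lemma = solve-∀

  -- k is read off a single coordinate i, where v is nonzero mod p; this is where m ≥ 1 is needed.
  reps-disjoint : Fin m → ∀ {k k′ w} → k < p → k′ < p →
                  PerfectRep p (k · v) w → PerfectRep p (k′ · v) w → k ≡ k′
  reps-disjoint i {k} {k′} {w} k<p k′<p w-rep w-rep′ = sym (residues-injective k′<p k<p p∣k′-k)
    where
    p∣k′-k : (+ p) ∣ + k′ - + k
    p∣k′-k = ∣-*-∤ˡ p-prime (p∤v i) (subst ((+ p) ∣_) (lemma (lookup w i) (+ k) (+ k′) (lookup v i))
      (∣m∣n⇒∣m-n (IsPerfectRep.congruent (Equivalence.to (perfectRep⇔ k w) w-rep) i)
                 (IsPerfectRep.congruent (Equivalence.to (perfectRep⇔ k′ w) w-rep′) i)))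
      where
      lemma : ∀ w k k′ v → w - k * v - (w - k′ * v) ≡ v * (k′ - k)
      lemma = solve-∀

  HasCard-Reps : Fin m → (n : ℕ → ℕ) → (∀ k → 1 ≤ k → k < p → HasCard (PerfectRep p (k · v)) (n k)) →
                 HasCard Reps (sumTo (p ∸ 1) n)
  HasCard-Reps i n card = HasCard-resp-⇔ bounds
    (HasCard-⋃ (λ k → PerfectRep p (k · v)) n (p ∸ 1)
      (λ k 1≤k k≤p-1 → card k 1≤k (Equivalence.to ≤∸1⇔< k≤p-1))
      (λ {w = w} _ k≤p-1 _ k′≤p-1 →
         reps-disjoint i {w = w} (Equivalence.to ≤∸1⇔< k≤p-1) (Equivalence.to ≤∸1⇔< k′≤p-1)))
    where
    bounds : ∀ w → (∃ λ k → 1 ≤ k × k ≤ p ∸ 1 × PerfectRep p (k · v) w) ⇔ Reps w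
    bounds w = mk⇔ (λ (k , 1≤k , k≤p-1 , rep) → k , 1≤k , Equivalence.to ≤∸1⇔< k≤p-1 , rep)
                   (λ (k , 1≤k , k<p , rep) → k , 1≤k , Equivalence.from ≤∸1⇔< k<p , rep)

  ≡0[mod]⇔∣ : ∀ {x} → x ≡ + 0 [mod p ] ⇔ (+ p) ∣ x
  ≡0[mod]⇔∣ {x} = mk⇔ (subst ((+ p) ∣_) (ℤ.+-identityʳ x) ∘ ∣ᵤ⇒∣)
                      (∣⇒∣ᵤ ∘ subst ((+ p) ∣_) (sym (ℤ.+-identityʳ x)))

  p*p≢0 : + p * + p ≢ 0ℤ
  p*p≢0 p*p≡0 = ℕ.≢-nonZero⁻¹ p (ℤ.+-injective ([ id , id ]′ (ℤ.i*j≡0⇒i≡0∨j≡0 (+ p) p*p≡0)))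

  module FromGenerated (Q : Matrix m) (regular : Regular Q) (orthogonal : Orthogonal Q)
                       (pQ-integral : IntegralMatrix (scale p Q))
                       (nonzero-entry : ∃₂ λ i j → ¬ (pQℤ p Q i j ≡ + 0 [mod p ]))
                       (column-multiples : ∀ j → ∃ λ c → ∀ i → pQℤ p Q i j ≡ c * lookup v i [mod p ]) where

    W : Fin m → Fin m → ℤ
    W j i = proj₁ (pQ-integral i j)

    Q≡W/p : ∀ i j → Q i j ≡ ι (W j i) ℚ.* p⁻¹ p
    Q≡W/p i j = sym (x≡p*y⇒x*p⁻¹≡y p (sym (proj₂ (pQ-integral i j))))

    pQ≡W : ∀ i j → pQℤ p Q i j ≡ W j i
    pQ≡W i j = trans (cong ℚ.↥_ (proj₂ (pQ-integral i j))) (↥-ι (W j i))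

    columns : OrthogonalColumns (+ p * + p) W
    columns = Equivalence.to (orthogonal⇔orthogonalColumns p W Q Q≡W/p) orthogonal

    rows : ∀ i → rowSum W i ≡ + p
    rows = Equivalence.to (regular⇔rowSums p W Q Q≡W/p) regular

    c : Fin m → ℤ
    c j = proj₁ (column-multiples j)

    W≡cv : ∀ j i → (+ p) ∣ W j i - c j * lookup v i
    W≡cv j i = subst (λ x → (+ p) ∣ x - c j * lookup v i) (pQ≡W i j) (∣ᵤ⇒∣ (proj₂ (column-multiples j) i))

    p∣column : ∀ {j} → (+ p) ∣ c j → ∀ i → (+ p) ∣ W j i
    p∣column {j} p∣cⱼ i = subst ((+ p) ∣_) (lemma (W j i) (c j * lookup v i))
      (∣m∣n⇒∣m+n (W≡cv j i) (∣m⇒∣m*n (lookup v i) p∣cⱼ))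
      where
      lemma : ∀ a b → a - b + b ≡ a
      lemma = solve-∀

    i₀ j₀ : Fin m
    i₀ = proj₁ nonzero-entry
    j₀ = proj₁ (proj₂ nonzero-entry)

    p∤c₀ : ¬ (+ p) ∣ c j₀
    p∤c₀ p∣c₀ = proj₂ (proj₂ nonzero-entry)
      (Equivalence.from ≡0[mod]⇔∣ (subst ((+ p) ∣_) (sym (pQ≡W i₀ j₀)) (p∣column p∣c₀ i₀)))

    zero-entry : ∀ {j} → (+ p) ∣ c j → ∃ λ i → W j₀ i ≡ 0ℤ
    zero-entry p∣cⱼ = divisible-column⇒zero-entry columns {P = + p} refl (p∣column p∣cⱼ) λ { refl → p∤c₀ p∣cⱼ }

    -- Were p ∣ c j, column j would be p times a unit vector, and orthogonality would force a zero
    -- entry into column j₀, all of whose entries are nonzero mod p.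
    p∤c : ∀ j → ¬ (+ p) ∣ c j
    p∤c j p∣cⱼ = let i , W₀ᵢ≡0 = zero-entry p∣cⱼ in
      p∤entries {w = W j₀} p∤c₀ (W≡cv j₀) i (subst ((+ p) ∣_) (sym W₀ᵢ≡0) (divides 0ℤ refl))

    k : Fin m → ℕ
    k j = c j ℤ.%ℕ p

    k<p : ∀ j → k j < p
    k<p j = n%ℕd<d (c j) p

    1≤k : ∀ j → 1 ≤ k j
    1≤k j = ℕ.n≢0⇒n>0 λ kⱼ≡0 →
      p∤c j (subst ((+ p) ∣_) (trans (cong (λ x → c j - + x) kⱼ≡0) (ℤ.+-identityʳ (c j))) (∣-residue (c j) p))

    column-rep : ∀ j → IsPerfectRep p (λ i → + k j * lookup v i) (W j)
    column-rep j = record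
      { congruent = λ i → subst ((+ p) ∣_) (lemma (W j i) (c j) (+ k j) (lookup v i))
                      (∣m∣n⇒∣m+n (W≡cv j i) (∣m⇒∣m*n (lookup v i) (∣-residue (c j) p)))
      ; sum≡p     = columnSums≡ columns {P = + p} refl rows j
      ; norm≡p²   = OrthogonalColumns.norm columns j
      }
      where
      lemma : ∀ w c k v → w - c * v + (c - k) * v ≡ w - k * v
      lemma = solve-∀

    column : Fin m → Vec ℤ m
    column j = tabulate (W j)

    column-injective : ∀ {j l} → column j ≡ column l → j ≡ l
    column-injective {j} {l} colⱼ≡colₗ = decidable-stable (j ≟ l) λ j≢l → p*p≢0 (begin
      + p * + p          ≡⟨ OrthogonalColumns.norm columns j ⟨
      dot (W j) (W j)    ≡⟨ sum-cong (λ i → cong (W j i *_) (Wⱼ≗Wₗ i)) ⟩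
      dot (W j) (W l)    ≡⟨ OrthogonalColumns.orthogonal columns j l j≢l ⟩
      0ℤ                 ∎)
      where
      open ≡-Reasoning
      Wⱼ≗Wₗ : ∀ i → W j i ≡ W l i
      Wⱼ≗Wₗ i = trans (sym (Vec.lookup∘tabulate (W j) i))
                      (trans (cong (λ u → lookup u i) colⱼ≡colₗ) (Vec.lookup∘tabulate (W l) i))

    reps⇔columns : ∀ w → Reps w ⇔ (∃ λ j → w ≡ column j)
    reps⇔columns w = mk⇔ rep⇒column column⇒rep
      where
      rep⇒column : Reps w → ∃ λ j → w ≡ column j
      rep⇒column (kw , 1≤kw , kw<p , w-rep) =
        let j , w≗Wⱼ = sum≢0⇒∃ (λ j → dot (lookup w) (W j)) dichotomy Σ≢0
        in j , Pointwise-≡⇒≡ (ext λ i → trans (w≗Wⱼ i) (sym (Vec.lookup∘tabulate (W j) i)))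
        where
        w-rep′ : IsPerfectRep p (λ i → + kw * lookup v i) (lookup w)
        w-rep′ = Equivalence.to (perfectRep⇔ kw w) w-rep
        dichotomy : ∀ j → dot (lookup w) (W j) ≡ 0ℤ ⊎ (∀ i → lookup w i ≡ W j i)
        dichotomy j = perfectReps-orthogonal-or-equal p-prime p≢2 (p∤k 1≤kw kw<p) (p∤k (1≤k j) (k<p j))
                        w-rep′ (column-rep j)
        Σ≢0 : sumℤ (λ j → dot (lookup w) (W j)) ≢ 0ℤ
        Σ≢0 Σ≡0 = p*p≢0 (begin
          + p * + p                                ≡⟨ cong (_* + p) (IsPerfectRep.sum≡p w-rep′) ⟨
          sumℤ (lookup w) * + p                    ≡⟨ sum-*ʳ (+ p) (lookup w) ⟨
          dot (lookup w) (λ _ → + p)               ≡⟨ sum-cong (λ i → cong (lookup w i *_) (rows i)) ⟨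
          dot (lookup w) (rowSum W)                ≡⟨ sum-dot-columns W (lookup w) ⟨
          sumℤ (λ j → dot (lookup w) (W j))        ≡⟨ Σ≡0 ⟩
          0ℤ                                       ∎)
          where open ≡-Reasoning
      column⇒rep : (∃ λ j → w ≡ column j) → Reps w
      column⇒rep (j , refl) = k j , 1≤k j , k<p j , Equivalence.from (perfectRep⇔ (k j) (column j))
        (IsPerfectRep-cong (λ i → sym (Vec.lookup∘tabulate (W j) i)) (column-rep j))

    HasCard-Reps-m : HasCard Reps m
    HasCard-Reps-m = HasCard-resp-⇔ (λ w → ⇔.sym (reps⇔columns w)) (HasCard-image column column-injective)

  module FromReps (i₀ : Fin m) (L : List (Vec ℤ m)) (L-unique : Unique L)
                  (L⇔Reps : ∀ w → w ∈ L ⇔ Reps w) (∣L∣≡m : List.length L ≡ m) where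

    column : Fin m → Vec ℤ m
    column j = List.lookup L (Fin.cast (sym ∣L∣≡m) j)

    column-injective : ∀ {j l} → column j ≡ column l → j ≡ l
    column-injective {j} {l} colⱼ≡colₗ = Fin.toℕ-injective (begin
      Fin.toℕ j                          ≡⟨ Fin.toℕ-cast (sym ∣L∣≡m) j ⟨
      Fin.toℕ (Fin.cast (sym ∣L∣≡m) j)   ≡⟨ cong Fin.toℕ (lookup-injective L-unique _ _ colⱼ≡colₗ) ⟩
      Fin.toℕ (Fin.cast (sym ∣L∣≡m) l)   ≡⟨ Fin.toℕ-cast (sym ∣L∣≡m) l ⟩
      Fin.toℕ l                          ∎)
      where open ≡-Reasoning

    column-rep : ∀ j → Reps (column j)
    column-rep j = Equivalence.to (L⇔Reps (column j)) (∈-lookup (Fin.cast (sym ∣L∣≡m) j))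

    k : Fin m → ℕ
    k j = proj₁ (column-rep j)

    p∤kⱼ : ∀ j → ¬ (+ p) ∣ + k j
    p∤kⱼ j = let _ , 1≤k , k<p , _ = column-rep j in p∤k 1≤k k<p

    W : Fin m → Fin m → ℤ
    W j = lookup (column j)

    W-rep : ∀ j → IsPerfectRep p (λ i → + k j * lookup v i) (W j)
    W-rep j = Equivalence.to (perfectRep⇔ (k j) (column j)) (proj₂ (proj₂ (proj₂ (column-rep j))))

    p∤W : ∀ j i → ¬ (+ p) ∣ W j i
    p∤W j = p∤entries (p∤kⱼ j) (IsPerfectRep.congruent (W-rep j))

    columns : OrthogonalColumns (+ p * + p) W
    columns = record
      { norm       = λ j → IsPerfectRep.norm≡p² (W-rep j)
      ; orthogonal = orthogonal
      }
      where
      orthogonal : ∀ j l → j ≢ l → dot (W j) (W l) ≡ 0ℤ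
      orthogonal j l j≢l = [ id , (λ Wⱼ≗Wₗ → ⊥-elim (j≢l (column-injective (Pointwise-≡⇒≡ (ext Wⱼ≗Wₗ))))) ]′
        (perfectReps-orthogonal-or-equal p-prime p≢2 (p∤kⱼ j) (p∤kⱼ l) (W-rep j) (W-rep l))

    rows : ∀ i → rowSum W i ≡ + p
    rows = rowSums≡ columns {P = + p} refl (λ j → IsPerfectRep.sum≡p (W-rep j))

    Q : Matrix m
    Q i j = ι (W j i) ℚ.* p⁻¹ p

    pQ≡W : ∀ i j → scale p Q i j ≡ ι (W j i)
    pQ≡W i j = p*[x*p⁻¹]≡x p (ι (W j i))

    pQℤ≡W : ∀ i j → pQℤ p Q i j ≡ W j i
    pQℤ≡W i j = trans (cong ℚ.↥_ (pQ≡W i j)) (↥-ι (W j i))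

    kQ-not-integral : ∀ s → 1 ≤ s → s < p → ¬ IntegralMatrix (scale s Q)
    kQ-not-integral s 1≤s s<p sQ-integral =
      p∤W i₀ i₀ (∣-*-∤ˡ p-prime (p∤k 1≤s s<p) (divides z (trans sW≡pz (ℤ.*-comm (+ p) z))))
      where
      open ≡-Reasoning
      z : ℤ
      z = proj₁ (sQ-integral i₀ i₀)
      sW≡pz : + s * W i₀ i₀ ≡ + p * z
      sW≡pz = Equivalence.to (ι*p⁻¹≡ι⇔ p) (begin
        ι (+ s * W i₀ i₀) ℚ.* p⁻¹ p              ≡⟨ cong (ℚ._* p⁻¹ p) (ι-* (+ s) (W i₀ i₀)) ⟩
        ι (+ s) ℚ.* ι (W i₀ i₀) ℚ.* p⁻¹ p        ≡⟨ ℚ.*-assoc (ι (+ s)) (ι (W i₀ i₀)) (p⁻¹ p) ⟩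
        ι (+ s) ℚ.* (ι (W i₀ i₀) ℚ.* p⁻¹ p)      ≡⟨ proj₂ (sQ-integral i₀ i₀) ⟩
        ι z                                      ∎)

    column-multiples : ∀ j → ∃ λ c → ∀ i → pQℤ p Q i j ≡ c * lookup v i [mod p ]
    column-multiples j = + k j , λ i → ∣⇒∣ᵤ
      (subst (λ x → (+ p) ∣ x - + k j * lookup v i) (sym (pQℤ≡W i j)) (IsPerfectRep.congruent (W-rep j) i))

    generates : CanGenerate p v
    generates = Q , (regular , orthogonal , level , rank-1) , column-multiples
      where
      regular : Regular Q
      regular = Equivalence.from (regular⇔rowSums p W Q λ _ _ → refl) rows
      orthogonal : Orthogonal Q
      orthogonal = Equivalence.from (orthogonal⇔orthogonalColumns p W Q λ _ _ → refl) columns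
      level : HasLevel Q p
      level = ℕ.>-nonZero⁻¹ p , (λ i j → W j i , pQ≡W i j) , kQ-not-integral
      rank-1 : Rank1Mod p (pQℤ p Q)
      rank-1 = (i₀ , i₀ , p∤W i₀ i₀ ∘ subst ((+ p) ∣_) (pQℤ≡W i₀ i₀) ∘ Equivalence.to ≡0[mod]⇔∣)
             , lookup v , (i₀ , p∤v i₀ ∘ Equivalence.to ≡0[mod]⇔∣) , column-multiples

  generated⇒HasCard-Reps : CanGenerate p v → HasCard Reps m
  generated⇒HasCard-Reps (Q , (regular , orthogonal , (_ , pQ-integral , _) , (nonzero-entry , _)) , multiples) =
    FromGenerated.HasCard-Reps-m Q regular orthogonal pQ-integral nonzero-entry multiples

  HasCard-Reps⇒generates : Fin m → HasCard Reps m → CanGenerate p v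
  HasCard-Reps⇒generates i₀ (L , L-unique , L⇔Reps , ∣L∣≡m) = FromReps.generates i₀ L L-unique L⇔Reps ∣L∣≡m

theorem3p4 : (p : ℕ) → Prime p → p ≢ 2 → (m : ℕ) → 1 ≤ m → (v : Vec ℤ m)
    → (∀ i → ¬ ((+ p) ∣ℤ lookup v i))
    → (n : ℕ → ℕ) → (∀ k → 1 ≤ k → k < p → HasCard (PerfectRep p (k · v)) (n k))
    → (CanGenerate p v ⇔ sumTo (p ∸ 1) n ≡ m)
theorem3p4 p p-prime p≢2 (suc m) _ v p∤v n card = mk⇔
  (λ generated → HasCard-unique Σcard (generated⇒HasCard-Reps generated) (λ _ → ⇔.refl))
  (λ Σn≡m → HasCard-Reps⇒generates zero (subst (HasCard Reps) Σn≡m Σcard))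
  where
  open Representatives p-prime p≢2 v (λ i → p∤v i ∘ ∣⇒∣ᵤ)
  Σcard : HasCard Reps (sumTo (p ∸ 1) n)
  Σcard = HasCard-Reps zero n card
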